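{- Let $\mathcal{M},\mathcal{N}$ be matroids on a common finite ground set $V$. Then for every positive integer $q$, \[\nu_{1,1}(\mathcal{M},\mathcal{N})\ge \left\lceil \frac{\nu_{q,q}(\mathcal{M},\mathcal{N})}{q}\right\rceil.\]
   Context: A matroid on $V$ is a nonempty family of subsets of $V$ (independent sets) closed under subsets and satisfying the augmentation axiom. For sets $A_1,\ldots,A_k$ and an element $v$, $\#v(A_1,\ldots,A_k)$ denotes the number of indices $i$ with $v\in A_i$. For positive integers $p,q$ and matroids $\mathcal{M},\mathcal{N}$ on $V$, \[\nu_{p,q}(\mathcal{M},\mathcal{N})=\max_{A_1,\ldots,A_p\in\mathcal{M},\ B_1,\ldots,B_q\in\mathcal{N}}\ \sum_{v\in V}\min\big(\#v(A_1,\ldots,A_p),\#v(B_1,\ldots,B_q)\big).\] In particular $\nu_{1,1}(\mathcal{M},\mathcal{N})$ is the maximum size of a set independent in both $\mathcal{M}$ and $\mathcal{N}$. -}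

module Defs where

open import Data.Nat using (ℕ; zero; suc; _+_; _*_; _≤_; _<_; _⊓_; NonZero)
open import Data.Nat.DivMod using (_/_)
open import Data.Fin using (Fin)
open import Data.Fin.Subset using (Subset; _∈_; _⊆_; ∣_∣; ⁅_⁆; _∪_; _∉_)
open import Data.Bool using (true; false)
open import Data.Vec using (lookup)
open import Data.Product using (Σ; _×_; ∃; ∃-syntax; _,_)
open import Relation.Nullary using (¬_)

record Matroid (n : ℕ) : Set₁ where
  field
    Indep       : Subset n → Set
    nonempty    : ∃[ A ] Indep A
    down-closed : ∀ {A B} → B ⊆ A → Indep A → Indep B
    augment     : ∀ {A B} → Indep A → Indep B → ∣ A ∣ < ∣ B ∣ →
                  ∃[ v ] (v ∈ B × v ∉ A × Indep (A ∪ ⁅ v ⁆))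
open Matroid public

count : ∀ {n} (k : ℕ) → (Fin k → Subset n) → Fin n → ℕ
count zero    A v = 0
count (suc k) A v with lookup (A Fin.zero) v
... | true  = suc (count k (λ i → A (Fin.suc i)) v)
... | false = count k (λ i → A (Fin.suc i)) v

sumFin : (n : ℕ) → (Fin n → ℕ) → ℕ
sumFin zero    f = 0
sumFin (suc n) f = f Fin.zero + sumFin n (λ i → f (Fin.suc i))

objective : ∀ {n} (p q : ℕ) → (Fin p → Subset n) → (Fin q → Subset n) → ℕ
objective {n} p q A B = sumFin n (λ v → count p A v ⊓ count q B v)

Admissible : ∀ {n} (p q : ℕ) → Matroid n → Matroid n →
             (Fin p → Subset n) → (Fin q → Subset n) → Set
Admissible p q M N A B = (∀ i → Indep M (A i)) × (∀ j → Indep N (B j))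

IsNu : ∀ {n} (p q : ℕ) → Matroid n → Matroid n → ℕ → Set
IsNu p q M N k =
  (∃[ A ] ∃[ B ] (Admissible p q M N A B × objective p q A B ≡' k)) ×
  (∀ A B → Admissible p q M N A B → objective p q A B ≤ k)
  where
  open import Relation.Binary.PropositionalEquality renaming (_≡_ to _≡'_)

⌈_/_⌉ : (m q : ℕ) → .{{NonZero q}} → ℕ
⌈ m / suc q ⌉ = (m + q) / suc q

-- By the min–max theorem for matroid intersection there is a common independent set K and a
-- cover V = U ∪ W with r_M(U) + r_N(W) ≤ ∣K∣ ≤ ν₁₁.  Every v contributing to the objective of
-- A₁..A_p, B₁..B_p lies in U or in W, so the objective is at most
-- Σᵢ ∣Aᵢ ∩ U∣ + Σⱼ ∣Bⱼ ∩ W∣ ≤ p·r_M(U) + p·r_N(W) ≤ p·ν₁₁.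
-- The min–max cover is built element by element by deletion and contraction: when x is
-- a loop of a contraction it joins U or W; otherwise the covers for the deletion and for the
-- contraction by x are uncrossed by submodularity of the two rank functions.

module Submission where

open import Defs
open import Data.Nat as ℕ using (ℕ; suc; _+_; _*_; _≤_; _<_; _⊓_; _≤?_; _<?_; z≤n; s≤s)
open import Data.Nat.Properties
open import Data.Nat.DivMod using (_/_; m<n*o⇒m/o<n)
open import Data.Fin as Fin using (Fin)
open import Data.Fin.Subset renaming (⊥ to ∅)
open import Data.Fin.Subset.Properties
open import Data.Bool using (true; false; _∧_; if_then_else_)
open import Data.Bool.Properties using (∧-identityʳ)
open import Data.Vec using ([]; _∷_; lookup)
open import Data.Vec.Properties using (lookup-zipWith; []=⇒lookup)
open import Data.List using (List; []; _∷_; allFin)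
open import Data.List.Relation.Unary.All as All using (All; []; _∷_)
open import Data.List.Membership.Propositional.Properties using (∈-allFin)
open import Data.Product using (_×_; ∃-syntax; _,_; proj₁; proj₂)
open import Data.Sum using (_⊎_; inj₁; inj₂; [_,_])
open import Function using (_∘_)
open import Data.Empty using (⊥-elim)
open import Relation.Nullary using (¬_; yes; no)
open import Relation.Nullary.Decidable using (_×-dec_; decidable-stable; ¬¬-excluded-middle)
open import Relation.Unary using (Decidable)
open import Relation.Binary.PropositionalEquality using (_≡_; refl; sym; trans; cong; cong₂; subst; module ≡-Reasoning)
open import Algebra.Properties.CommutativeSemigroup +-commutativeSemigroup using (interchange)

private
  variable
    m : ℕ
    x : Fin m
    p q r : Subset m

∈∪ˡ : x ∈ p → x ∈ p ∪ q
∈∪ˡ x∈p = x∈p∪q⁺ (inj₁ x∈p)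

∈∪ʳ : x ∈ q → x ∈ p ∪ q
∈∪ʳ x∈q = x∈p∪q⁺ (inj₂ x∈q)

∪-lub : p ⊆ r → q ⊆ r → p ∪ q ⊆ r
∪-lub {p = p} {q = q} p⊆r q⊆r x∈p∪q = [ p⊆r , q⊆r ] (x∈p∪q⁻ p q x∈p∪q)

∩-glb : p ⊆ q → p ⊆ r → p ⊆ q ∩ r
∩-glb p⊆q p⊆r x∈p = x∈p∩q⁺ (p⊆q x∈p , p⊆r x∈p)

⊆-∪ˡ : p ⊆ q → p ⊆ q ∪ r
⊆-∪ˡ p⊆q x∈p = ∈∪ˡ (p⊆q x∈p)

∣p∪q∣+∣p∩q∣≡∣p∣+∣q∣ : (p q : Subset m) → ∣ p ∪ q ∣ + ∣ p ∩ q ∣ ≡ ∣ p ∣ + ∣ q ∣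
∣p∪q∣+∣p∩q∣≡∣p∣+∣q∣ []            []            = refl
∣p∪q∣+∣p∩q∣≡∣p∣+∣q∣ (inside  ∷ p) (inside  ∷ q) =
  cong suc (trans (+-suc _ _) (trans (cong suc (∣p∪q∣+∣p∩q∣≡∣p∣+∣q∣ p q)) (sym (+-suc _ _))))
∣p∪q∣+∣p∩q∣≡∣p∣+∣q∣ (inside  ∷ p) (outside ∷ q) = cong suc (∣p∪q∣+∣p∩q∣≡∣p∣+∣q∣ p q)
∣p∪q∣+∣p∩q∣≡∣p∣+∣q∣ (outside ∷ p) (inside  ∷ q) =
  trans (cong suc (∣p∪q∣+∣p∩q∣≡∣p∣+∣q∣ p q)) (sym (+-suc _ _))
∣p∪q∣+∣p∩q∣≡∣p∣+∣q∣ (outside ∷ p) (outside ∷ q) = ∣p∪q∣+∣p∩q∣≡∣p∣+∣q∣ p q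

x∉p⇒∣p∣<∣p∪⁅x⁆∣ : x ∉ p → ∣ p ∣ < ∣ p ∪ ⁅ x ⁆ ∣
x∉p⇒∣p∣<∣p∪⁅x⁆∣ {x = x} x∉p = p⊂q⇒∣p∣<∣q∣ (p⊆p∪q _ , x , ∈∪ʳ (x∈⁅x⁆ x) , x∉p)

∣p∪⁅x⁆∣≤1+∣p∣ : (p : Subset m) (x : Fin m) → ∣ p ∪ ⁅ x ⁆ ∣ ≤ suc ∣ p ∣
∣p∪⁅x⁆∣≤1+∣p∣ p x = begin
  ∣ p ∪ ⁅ x ⁆ ∣                    ≤⟨ m≤m+n _ ∣ p ∩ ⁅ x ⁆ ∣ ⟩
  ∣ p ∪ ⁅ x ⁆ ∣ + ∣ p ∩ ⁅ x ⁆ ∣  ≡⟨ ∣p∪q∣+∣p∩q∣≡∣p∣+∣q∣ p ⁅ x ⁆ ⟩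
  ∣ p ∣ + ∣ ⁅ x ⁆ ∣                ≡⟨ cong (∣ p ∣ +_) (∣⁅x⁆∣≡1 x) ⟩
  ∣ p ∣ + 1                        ≡⟨ +-comm ∣ p ∣ 1 ⟩
  suc ∣ p ∣                        ∎
  where open ≤-Reasoning

indicator : Subset m → Fin m → ℕ
indicator p v = if lookup p v then 1 else 0

count-suc : ∀ k (F : Fin (suc k) → Subset m) v →
            count (suc k) F v ≡ indicator (F Fin.zero) v + count k (F ∘ Fin.suc) v
count-suc k F v with lookup (F Fin.zero) v
... | true  = refl
... | false = refl

∣p∣≡sumFin-indicator : (p : Subset m) → ∣ p ∣ ≡ sumFin m (indicator p)
∣p∣≡sumFin-indicator []            = refl
∣p∣≡sumFin-indicator (inside  ∷ p) = cong suc (∣p∣≡sumFin-indicator p)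
∣p∣≡sumFin-indicator (outside ∷ p) = ∣p∣≡sumFin-indicator p

sumFin-cong : ∀ k {f g : Fin k → ℕ} → (∀ i → f i ≡ g i) → sumFin k f ≡ sumFin k g
sumFin-cong ℕ.zero    f≡g = refl
sumFin-cong (suc k) f≡g = cong₂ _+_ (f≡g Fin.zero) (sumFin-cong k (f≡g ∘ Fin.suc))

sumFin-mono-≤ : ∀ k {f g : Fin k → ℕ} → (∀ i → f i ≤ g i) → sumFin k f ≤ sumFin k g
sumFin-mono-≤ ℕ.zero    f≤g = z≤n
sumFin-mono-≤ (suc k) f≤g = +-mono-≤ (f≤g Fin.zero) (sumFin-mono-≤ k (f≤g ∘ Fin.suc))

sumFin-distrib-+ : ∀ k (f g : Fin k → ℕ) → sumFin k (λ i → f i + g i) ≡ sumFin k f + sumFin k g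
sumFin-distrib-+ ℕ.zero    f g = refl
sumFin-distrib-+ (suc k) f g =
  trans (cong (f Fin.zero + g Fin.zero +_) (sumFin-distrib-+ k (f ∘ Fin.suc) (g ∘ Fin.suc)))
        (interchange (f Fin.zero) _ _ _)

sumFin≤k*c : ∀ k {f : Fin k → ℕ} {c} → (∀ i → f i ≤ c) → sumFin k f ≤ k * c
sumFin≤k*c ℕ.zero    f≤c = z≤n
sumFin≤k*c (suc k) f≤c = +-mono-≤ (f≤c Fin.zero) (sumFin≤k*c k (f≤c ∘ Fin.suc))

sumFin-count : ∀ k (F : Fin k → Subset m) → sumFin m (count k F) ≡ sumFin k (λ i → ∣ F i ∣)
sumFin-count {m = m} ℕ.zero    F = sumFin-zero m
  where
  sumFin-zero : ∀ m → sumFin m (λ _ → 0) ≡ 0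
  sumFin-zero ℕ.zero    = refl
  sumFin-zero (suc m) = sumFin-zero m
sumFin-count {m = m} (suc k) F = begin
  sumFin m (count (suc k) F)
    ≡⟨ sumFin-cong m (count-suc k F) ⟩
  sumFin m (λ v → indicator (F Fin.zero) v + count k (F ∘ Fin.suc) v)
    ≡⟨ sumFin-distrib-+ m _ _ ⟩
  sumFin m (indicator (F Fin.zero)) + sumFin m (count k (F ∘ Fin.suc))
    ≡⟨ cong₂ _+_ (sym (∣p∣≡sumFin-indicator (F Fin.zero))) (sumFin-count k (F ∘ Fin.suc)) ⟩
  ∣ F Fin.zero ∣ + sumFin k (λ i → ∣ F (Fin.suc i) ∣) ∎
  where open ≡-Reasoning

count-∩ : ∀ k (F : Fin k → Subset m) {U v} → v ∈ U → count k (λ i → F i ∩ U) v ≡ count k F v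
count-∩ ℕ.zero    F v∈U = refl
count-∩ (suc k) F {U} {v} v∈U = begin
  count (suc k) (λ i → F i ∩ U) v
    ≡⟨ count-suc k (λ i → F i ∩ U) v ⟩
  indicator (F Fin.zero ∩ U) v + count k (λ i → F (Fin.suc i) ∩ U) v
    ≡⟨ cong₂ _+_ (cong (λ b → if b then 1 else 0) lookup-∩) (count-∩ k (F ∘ Fin.suc) v∈U) ⟩
  indicator (F Fin.zero) v + count k (F ∘ Fin.suc) v
    ≡⟨ count-suc k F v ⟨
  count (suc k) F v ∎
  where
  open ≡-Reasoning
  lookup-∩ : lookup (F Fin.zero ∩ U) v ≡ lookup (F Fin.zero) v
  lookup-∩ = trans (lookup-zipWith _∧_ v (F Fin.zero) U)
                   (trans (cong (lookup (F Fin.zero) v ∧_) ([]=⇒lookup v∈U)) (∧-identityʳ _))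

MaxCard : (Subset m → Set) → Set
MaxCard P = ∃[ Y ] (P Y × (∀ Z → P Z → ∣ Z ∣ ≤ ∣ Y ∣))

maxCard? : {P : Subset m → Set} → Decidable P → (∀ Y → ¬ P Y) ⊎ MaxCard P
maxCard? {m = ℕ.zero} P? with P? []
... | yes P[] = inj₂ ([] , P[] , λ { [] _ → ≤-refl })
... | no ¬P[] = inj₁ λ { [] → ¬P[] }
maxCard? {m = suc m} P?
  with maxCard? (λ Y → P? (inside ∷ Y)) | maxCard? (λ Y → P? (outside ∷ Y))
... | inj₁ ¬in | inj₁ ¬out = inj₁ λ { (inside ∷ Z) → ¬in Z ; (outside ∷ Z) → ¬out Z }
... | inj₂ (Y , PY , max) | inj₁ ¬out =
  inj₂ (inside ∷ Y , PY , λ { (inside ∷ Z) PZ → s≤s (max Z PZ) ; (outside ∷ Z) PZ → ⊥-elim (¬out Z PZ) })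
... | inj₁ ¬in | inj₂ (Y , PY , max) =
  inj₂ (outside ∷ Y , PY , λ { (inside ∷ Z) PZ → ⊥-elim (¬in Z PZ) ; (outside ∷ Z) PZ → max Z PZ })
... | inj₂ (Y , PY , max) | inj₂ (Y′ , PY′ , max′) with ∣ Y′ ∣ ≤? suc ∣ Y ∣
...   | yes Y′≤ = inj₂ (inside ∷ Y , PY ,
          λ { (inside ∷ Z) PZ → s≤s (max Z PZ) ; (outside ∷ Z) PZ → ≤-trans (max′ Z PZ) Y′≤ })
...   | no Y′≰ = inj₂ (outside ∷ Y′ , PY′ ,
          λ { (inside ∷ Z) PZ → ≤-trans (s≤s (max Z PZ)) (<⇒≤ (≰⇒> Y′≰)) ; (outside ∷ Z) PZ → max′ Z PZ })

maxCard : {P : Subset m → Set} → Decidable P → ∀ {X} → P X → MaxCard P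
maxCard P? {X} PX with maxCard? P?
... | inj₁ ¬P = ⊥-elim (¬P X PX)
... | inj₂ max = max

module Rank {n} (M : Matroid n) (M? : Decidable (Indep M)) where

  ∅-indep : Indep M ∅
  ∅-indep = down-closed M (⊆-min (proj₁ (nonempty M))) (proj₂ (nonempty M))

  max-indep-between : ∀ {I C} → I ⊆ C → Indep M I →
                    MaxCard (λ Y → I ⊆ Y × Y ⊆ C × Indep M Y)
  max-indep-between {I} {C} I⊆C I∈M =
    maxCard (λ Y → I ⊆? Y ×-dec Y ⊆? C ×-dec M? Y) (⊆-refl , I⊆C , I∈M)

  private
    max-indep : ∀ C → MaxCard (λ Y → ∅ ⊆ Y × Y ⊆ C × Indep M Y)
    max-indep C = max-indep-between (⊆-min C) ∅-indep

  basis : Subset n → Subset n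
  basis C = proj₁ (max-indep C)

  basis⊆ : ∀ C → basis C ⊆ C
  basis⊆ C = proj₁ (proj₂ (proj₁ (proj₂ (max-indep C))))

  basis-indep : ∀ C → Indep M (basis C)
  basis-indep C = proj₂ (proj₂ (proj₁ (proj₂ (max-indep C))))

  rank : Subset n → ℕ
  rank C = ∣ basis C ∣

  indep⇒∣∣≤rank : ∀ {Z C} → Z ⊆ C → Indep M Z → ∣ Z ∣ ≤ rank C
  indep⇒∣∣≤rank {Z} {C} Z⊆C Z∈M =
    proj₂ (proj₂ (max-indep C)) Z (⊆-min Z , Z⊆C , Z∈M)

  rank≤∣∣ : ∀ C → rank C ≤ ∣ C ∣
  rank≤∣∣ C = p⊆q⇒∣p∣≤∣q∣ (basis⊆ C)

  rank-mono : ∀ {C D} → C ⊆ D → rank C ≤ rank D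
  rank-mono {C} C⊆D = indep⇒∣∣≤rank (⊆-trans (basis⊆ C) C⊆D) (basis-indep C)

  sumFin-∣∩∣≤k*rank : ∀ k {A : Fin k → Subset n} → (∀ i → Indep M (A i)) → ∀ U →
                      sumFin k (λ i → ∣ A i ∩ U ∣) ≤ k * rank U
  sumFin-∣∩∣≤k*rank k {A} A∈M U =
    sumFin≤k*c k (λ i → indep⇒∣∣≤rank (p∩q⊆q (A i) U) (down-closed M (p∩q⊆p (A i) U) (A∈M i)))

  -- A maximal independent set between I and C cannot be augmented from the basis of C.
  extend-to-rank : ∀ {I C} → I ⊆ C → Indep M I →
                 ∃[ I′ ] (I ⊆ I′ × I′ ⊆ C × Indep M I′ × rank C ≤ ∣ I′ ∣)
  extend-to-rank {I} {C} I⊆C I∈M with max-indep-between I⊆C I∈M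
  ... | Y , (I⊆Y , Y⊆C , Y∈M) , max with ∣ Y ∣ <? rank C
  ...   | no Y≮ = Y , I⊆Y , Y⊆C , Y∈M , ≮⇒≥ Y≮
  ...   | yes Y< with augment M Y∈M (basis-indep C) Y<
  ...     | v , v∈B , v∉Y , Yv∈M = ⊥-elim (<⇒≱ (x∉p⇒∣p∣<∣p∪⁅x⁆∣ v∉Y)
            (max (Y ∪ ⁅ v ⁆) (⊆-∪ˡ I⊆Y , ∪-lub Y⊆C (λ w∈v → subst (_∈ C) (sym (x∈⁅y⁆⇒x≡y v w∈v)) (basis⊆ C v∈B)) , Yv∈M)))

  rank-submodular : ∀ A B → rank (A ∩ B) + rank (A ∪ B) ≤ rank A + rank B
  rank-submodular A B with extend-to-rank (⊆-trans (basis⊆ (A ∩ B)) (⊆-∪ˡ (p∩q⊆p A B))) (basis-indep (A ∩ B))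
  ... | I , B∩⊆I , I⊆A∪B , I∈M , rank≤∣I∣ = begin
      rank (A ∩ B) + rank (A ∪ B)  ≤⟨ +-mono-≤ (p⊆q⇒∣p∣≤∣q∣ basis⊆IA∩IB) (≤-trans rank≤∣I∣ (p⊆q⇒∣p∣≤∣q∣ I⊆IA∪IB)) ⟩
      ∣ (I ∩ A) ∩ (I ∩ B) ∣ + ∣ (I ∩ A) ∪ (I ∩ B) ∣  ≡⟨ +-comm _ ∣ (I ∩ A) ∪ (I ∩ B) ∣ ⟩
      ∣ (I ∩ A) ∪ (I ∩ B) ∣ + ∣ (I ∩ A) ∩ (I ∩ B) ∣  ≡⟨ ∣p∪q∣+∣p∩q∣≡∣p∣+∣q∣ (I ∩ A) (I ∩ B) ⟩
      ∣ I ∩ A ∣ + ∣ I ∩ B ∣  ≤⟨ +-mono-≤ (traceBound A) (traceBound B) ⟩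
      rank A + rank B ∎
    where
    open ≤-Reasoning
    traceBound : ∀ C → ∣ I ∩ C ∣ ≤ rank C
    traceBound C = indep⇒∣∣≤rank (p∩q⊆q I C) (down-closed M (p∩q⊆p I C) I∈M)
    basis⊆IA∩IB : basis (A ∩ B) ⊆ (I ∩ A) ∩ (I ∩ B)
    basis⊆IA∩IB v∈ with x∈p∩q⁻ A B (basis⊆ (A ∩ B) v∈)
    ... | v∈A , v∈B = x∈p∩q⁺ (x∈p∩q⁺ (B∩⊆I v∈ , v∈A) , x∈p∩q⁺ (B∩⊆I v∈ , v∈B))
    I⊆IA∪IB : I ⊆ (I ∩ A) ∪ (I ∩ B)
    I⊆IA∪IB v∈I = [ (λ v∈A → ∈∪ˡ (x∈p∩q⁺ (v∈I , v∈A))) , (λ v∈B → ∈∪ʳ (x∈p∩q⁺ (v∈I , v∈B))) ]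
                    (x∈p∪q⁻ A B (I⊆A∪B v∈I))

  rank-dependent : ∀ {J x} → Indep M J → ¬ Indep M (J ∪ ⁅ x ⁆) → rank (J ∪ ⁅ x ⁆) ≤ ∣ J ∣
  rank-dependent {J} {x} J∈M ¬Jx∈M with ∣ J ∣ <? rank (J ∪ ⁅ x ⁆)
  ... | no J≮ = ≮⇒≥ J≮
  ... | yes J< with augment M J∈M (basis-indep (J ∪ ⁅ x ⁆)) J<
  ...   | v , v∈B , v∉J , Jv∈M with x∈p∪q⁻ J ⁅ x ⁆ (basis⊆ (J ∪ ⁅ x ⁆) v∈B)
  ...     | inj₁ v∈J = ⊥-elim (v∉J v∈J)
  ...     | inj₂ v∈x = ⊥-elim (¬Jx∈M (subst (λ w → Indep M (J ∪ ⁅ w ⁆)) (x∈⁅y⁆⇒x≡y x v∈x) Jv∈M))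

  rank-spanned : ∀ {J x U} → Indep M J → ¬ Indep M (J ∪ ⁅ x ⁆) → J ⊆ U → rank (U ∪ ⁅ x ⁆) ≤ rank U
  rank-spanned {J} {x} {U} J∈M ¬Jx∈M J⊆U = +-cancelˡ-≤ ∣ J ∣ _ _ (begin
      ∣ J ∣ + rank (U ∪ ⁅ x ⁆)
        ≤⟨ +-mono-≤ (indep⇒∣∣≤rank (∩-glb J⊆U (p⊆p∪q _)) J∈M)
                    (rank-mono (∪-lub (⊆-∪ˡ ⊆-refl) (λ v∈x → ∈∪ʳ (∈∪ʳ v∈x)))) ⟩
      rank (U ∩ (J ∪ ⁅ x ⁆)) + rank (U ∪ (J ∪ ⁅ x ⁆))  ≤⟨ rank-submodular U (J ∪ ⁅ x ⁆) ⟩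
      rank U + rank (J ∪ ⁅ x ⁆)  ≤⟨ +-monoʳ-≤ (rank U) (rank-dependent J∈M ¬Jx∈M) ⟩
      rank U + ∣ J ∣  ≡⟨ +-comm (rank U) _ ⟩
      ∣ J ∣ + rank U ∎)
    where open ≤-Reasoning

Covers : ∀ {n} → Subset n → Subset n → List (Fin n) → Set
Covers U W = All (λ v → v ∈ U ⊎ v ∈ W)

Covers-∩∪ : ∀ {n} {U₁ W₁ U₂ W₂ : Subset n} {xs} →
            Covers U₁ W₁ xs → Covers U₂ W₂ xs → Covers (U₁ ∩ U₂) (W₁ ∪ W₂) xs
Covers-∩∪ {U₁ = U₁} {W₁} {U₂} {W₂} c₁ c₂ = All.zipWith meetJoin (c₁ , c₂)
  where
  meetJoin : ∀ {v} → (v ∈ U₁ ⊎ v ∈ W₁) × (v ∈ U₂ ⊎ v ∈ W₂) → v ∈ U₁ ∩ U₂ ⊎ v ∈ W₁ ∪ W₂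
  meetJoin (inj₁ v∈U₁ , inj₁ v∈U₂) = inj₁ (x∈p∩q⁺ (v∈U₁ , v∈U₂))
  meetJoin (inj₂ v∈W₁ , _)         = inj₂ (∈∪ˡ v∈W₁)
  meetJoin (_         , inj₂ v∈W₂) = inj₂ (∈∪ʳ v∈W₂)

m+n≤o+[o+1]⇒m≤o⊎n≤o : ∀ {a b t} → a + b ≤ t + suc t → a ≤ t ⊎ b ≤ t
m+n≤o+[o+1]⇒m≤o⊎n≤o {a} {b} {t} a+b≤ with a ≤? t
... | yes a≤t = inj₁ a≤t
... | no a≰t = inj₂ (+-cancelˡ-≤ (suc t) _ _ (begin
    suc t + b  ≤⟨ +-monoˡ-≤ b (≰⇒> a≰t) ⟩
    a + b      ≤⟨ a+b≤ ⟩
    t + suc t  ≡⟨ +-comm t (suc t) ⟩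
    suc t + t  ∎))
  where open ≤-Reasoning

module MinMax {n} (M N : Matroid n) (M? : Decidable (Indep M)) (N? : Decidable (Indep N)) where

  private
    module RM = Rank M M?
    module RN = Rank N N?

  open RM using () renaming (rank to rM)
  open RN using () renaming (rank to rN)

  -- Requiring J ⊆ U, W encodes the contraction by J: rank U ∸ ∣ J ∣ is the rank of U ─ J in M / J.
  record Certificate (J : Subset n) (xs : List (Fin n)) : Set where
    field
      K      : Subset n
      K∈M    : Indep M K
      K∈N    : Indep N K
      U W    : Subset n
      J⊆U    : J ⊆ U
      J⊆W    : J ⊆ W
      covers : Covers U W xs
      cost≤  : rM U + rN W ≤ ∣ K ∣ + ∣ J ∣

  cost-uncross : ∀ U₁ W₁ U₂ W₂ →
    (rM (U₁ ∩ U₂) + rN (W₁ ∪ W₂)) + (rM (U₁ ∪ U₂) + rN (W₁ ∩ W₂)) ≤ (rM U₁ + rN W₁) + (rM U₂ + rN W₂)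
  cost-uncross U₁ W₁ U₂ W₂ = begin
    (rM (U₁ ∩ U₂) + rN (W₁ ∪ W₂)) + (rM (U₁ ∪ U₂) + rN (W₁ ∩ W₂))
      ≡⟨ interchange (rM (U₁ ∩ U₂)) _ _ _ ⟩
    (rM (U₁ ∩ U₂) + rM (U₁ ∪ U₂)) + (rN (W₁ ∪ W₂) + rN (W₁ ∩ W₂))
      ≤⟨ +-mono-≤ (RM.rank-submodular U₁ U₂)
                  (≤-trans (≤-reflexive (+-comm (rN (W₁ ∪ W₂)) _)) (RN.rank-submodular W₁ W₂)) ⟩
    (rM U₁ + rM U₂) + (rN W₁ + rN W₂)
      ≡⟨ interchange (rM U₁) _ _ _ ⟩
    (rM U₁ + rN W₁) + (rM U₂ + rN W₂) ∎
    where open ≤-Reasoning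

  module _ {J : Subset n} {x : Fin n} {xs : List (Fin n)} where

    private
      x∈J∪x : x ∈ J ∪ ⁅ x ⁆
      x∈J∪x = ∈∪ʳ (x∈⁅x⁆ x)

    add-loop-M : Indep M J → ¬ Indep M (J ∪ ⁅ x ⁆) → Certificate J xs → Certificate J (x ∷ xs)
    add-loop-M J∈M ¬Jx∈M C = record
      { K      = K ; K∈M = K∈M ; K∈N = K∈N
      ; U      = U ∪ ⁅ x ⁆
      ; W      = W
      ; J⊆U    = ⊆-∪ˡ J⊆U
      ; J⊆W    = J⊆W
      ; covers = inj₁ (∈∪ʳ (x∈⁅x⁆ x)) ∷ All.map (Data.Sum.map₁ ∈∪ˡ) covers
      ; cost≤  = ≤-trans (+-monoˡ-≤ (rN W) (RM.rank-spanned J∈M ¬Jx∈M J⊆U)) cost≤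
      }
      where open Certificate C

    add-loop-N : Indep N J → ¬ Indep N (J ∪ ⁅ x ⁆) → Certificate J xs → Certificate J (x ∷ xs)
    add-loop-N J∈N ¬Jx∈N C = record
      { K      = K ; K∈M = K∈M ; K∈N = K∈N
      ; U      = U
      ; W      = W ∪ ⁅ x ⁆
      ; J⊆U    = J⊆U
      ; J⊆W    = ⊆-∪ˡ J⊆W
      ; covers = inj₂ (∈∪ʳ (x∈⁅x⁆ x)) ∷ All.map (Data.Sum.map₂ ∈∪ˡ) covers
      ; cost≤  = ≤-trans (+-monoʳ-≤ (rM U) (RN.rank-spanned J∈N ¬Jx∈N J⊆W)) cost≤
      }
      where open Certificate C

    module Combine (C₁ : Certificate J xs) (C₂ : Certificate (J ∪ ⁅ x ⁆) xs) where
      private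
        module C₁ = Certificate C₁
        module C₂ = Certificate C₂

      J⊆U₂ : J ⊆ C₂.U
      J⊆U₂ = ⊆-trans (p⊆p∪q _) C₂.J⊆U

      J⊆W₂ : J ⊆ C₂.W
      J⊆W₂ = ⊆-trans (p⊆p∪q _) C₂.J⊆W

      costs≤ : (rM (C₁.U ∩ C₂.U) + rN (C₁.W ∪ C₂.W)) + (rM (C₁.U ∪ C₂.U) + rN (C₁.W ∩ C₂.W))
               ≤ (∣ C₁.K ∣ + ∣ J ∣) + (∣ C₂.K ∣ + suc ∣ J ∣)
      costs≤ = ≤-trans (cost-uncross C₁.U C₁.W C₂.U C₂.W)
                 (+-mono-≤ C₁.cost≤ (≤-trans C₂.cost≤ (+-monoʳ-≤ ∣ C₂.K ∣ (∣p∪⁅x⁆∣≤1+∣p∣ J x))))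

      with-largest : ∀ K → Indep M K → Indep N K → ∣ C₁.K ∣ ≤ ∣ K ∣ → ∣ C₂.K ∣ ≤ ∣ K ∣ → Certificate J (x ∷ xs)
      -- Both uncrossed covers together cost at most 2t + 1 for t = ∣ K ∣ + ∣ J ∣, so one costs at most t.
      with-largest K K∈M K∈N K₁≤K K₂≤K
        with m+n≤o+[o+1]⇒m≤o⊎n≤o (≤-trans costs≤
               (+-mono-≤ (+-monoˡ-≤ ∣ J ∣ K₁≤K) (≤-trans (+-monoˡ-≤ (suc ∣ J ∣) K₂≤K) (≤-reflexive (+-suc ∣ K ∣ ∣ J ∣)))))
      ... | inj₁ costα≤ = record
        { K = K ; K∈M = K∈M ; K∈N = K∈N
        ; U = C₁.U ∩ C₂.U ; W = C₁.W ∪ C₂.W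
        ; J⊆U = ∩-glb C₁.J⊆U J⊆U₂ ; J⊆W = ⊆-∪ˡ C₁.J⊆W
        ; covers = inj₂ (∈∪ʳ (C₂.J⊆W x∈J∪x)) ∷ Covers-∩∪ C₁.covers C₂.covers
        ; cost≤ = costα≤
        }
      ... | inj₂ costβ≤ = record
        { K = K ; K∈M = K∈M ; K∈N = K∈N
        ; U = C₁.U ∪ C₂.U ; W = C₁.W ∩ C₂.W
        ; J⊆U = ⊆-∪ˡ C₁.J⊆U ; J⊆W = ∩-glb C₁.J⊆W J⊆W₂
        ; covers = inj₁ (∈∪ʳ (C₂.J⊆U x∈J∪x)) ∷ All.map Data.Sum.swap
                     (Covers-∩∪ (All.map Data.Sum.swap C₁.covers) (All.map Data.Sum.swap C₂.covers))
        ; cost≤ = costβ≤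
        }

      combine : Certificate J (x ∷ xs)
      combine with ∣ C₁.K ∣ ≤? ∣ C₂.K ∣
      ... | yes K₁≤K₂ = with-largest C₂.K C₂.K∈M C₂.K∈N K₁≤K₂ ≤-refl
      ... | no K₁≰K₂  = with-largest C₁.K C₁.K∈M C₁.K∈N ≤-refl (<⇒≤ (≰⇒> K₁≰K₂))

    open Combine public using (combine)

  certificate : ∀ xs J → Indep M J → Indep N J → Certificate J xs
  certificate [] J J∈M J∈N = record
    { K = J ; K∈M = J∈M ; K∈N = J∈N
    ; U = J ; W = J ; J⊆U = ⊆-refl ; J⊆W = ⊆-refl
    ; covers = []
    ; cost≤ = +-mono-≤ (RM.rank≤∣∣ J) (RN.rank≤∣∣ J)
    }
  certificate (x ∷ xs) J J∈M J∈N with M? (J ∪ ⁅ x ⁆) | N? (J ∪ ⁅ x ⁆)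
  ... | no ¬Jx∈M | _         = add-loop-M J∈M ¬Jx∈M (certificate xs J J∈M J∈N)
  ... | yes _    | no ¬Jx∈N  = add-loop-N J∈N ¬Jx∈N (certificate xs J J∈M J∈N)
  ... | yes Jx∈M | yes Jx∈N  = combine (certificate xs J J∈M J∈N) (certificate xs (J ∪ ⁅ x ⁆) Jx∈M Jx∈N)

  matroid-intersection : ∃[ K ] (Indep M K × Indep N K ×
                          ∃[ U ] ∃[ W ] ((∀ v → v ∈ U ⊎ v ∈ W) × rM U + rN W ≤ ∣ K ∣))
  matroid-intersection =
    K , K∈M , K∈N , U , W , All.lookup covers ∘ ∈-allFin ,
    ≤-trans cost≤ (≤-reflexive (trans (cong (∣ K ∣ +_) (∣⊥∣≡0 n)) (+-identityʳ _)))
    where open Certificate (certificate (allFin n) ∅ RM.∅-indep RN.∅-indep)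

objective≤ : ∀ {n} {M N : Matroid n} (M? : Decidable (Indep M)) (N? : Decidable (Indep N)) →
             ∀ {p q A B} → Admissible p q M N A B → ∀ {U W} → (∀ v → v ∈ U ⊎ v ∈ W) →
             objective p q A B ≤ p * Rank.rank M M? U + q * Rank.rank N N? W
objective≤ {n} {M} {N} M? N? {p} {q} {A} {B} (A∈M , B∈N) {U} {W} covers = begin
  sumFin n (λ v → count p A v ⊓ count q B v)
    ≤⟨ sumFin-mono-≤ n min≤traces ⟩
  sumFin n (λ v → count p (λ i → A i ∩ U) v + count q (λ j → B j ∩ W) v)
    ≡⟨ sumFin-distrib-+ n _ _ ⟩
  sumFin n (count p (λ i → A i ∩ U)) + sumFin n (count q (λ j → B j ∩ W))
    ≡⟨ cong₂ _+_ (sumFin-count p (λ i → A i ∩ U)) (sumFin-count q (λ j → B j ∩ W)) ⟩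
  sumFin p (λ i → ∣ A i ∩ U ∣) + sumFin q (λ j → ∣ B j ∩ W ∣)
    ≤⟨ +-mono-≤ (Rank.sumFin-∣∩∣≤k*rank M M? p A∈M U) (Rank.sumFin-∣∩∣≤k*rank N N? q B∈N W) ⟩
  p * Rank.rank M M? U + q * Rank.rank N N? W ∎
  where
  open ≤-Reasoning
  min≤traces : ∀ v → count p A v ⊓ count q B v ≤ count p (λ i → A i ∩ U) v + count q (λ j → B j ∩ W) v
  min≤traces v with covers v
  ... | inj₁ v∈U = ≤-trans (m⊓n≤m _ _) (≤-trans (≤-reflexive (sym (count-∩ p A v∈U))) (m≤m+n _ _))
  ... | inj₂ v∈W = ≤-trans (m⊓n≤n _ _) (≤-trans (≤-reflexive (sym (count-∩ q B v∈W))) (m≤n+m _ _))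

objective-diagonal : ∀ {n} (K : Subset n) → objective 1 1 (λ _ → K) (λ _ → K) ≡ ∣ K ∣
objective-diagonal {n} K =
  trans (sumFin-cong n (λ v → trans (cong₂ _⊓_ (count₁ v) (count₁ v)) (⊓-idem _)))
        (sym (∣p∣≡sumFin-indicator K))
  where
  count₁ : ∀ v → count 1 (λ _ → K) v ≡ indicator K v
  count₁ v = trans (count-suc 0 (λ _ → K) v) (+-identityʳ _)

ν-scaling : ∀ {n} {M N : Matroid n} → Decidable (Indep M) → Decidable (Indep N) →
            ∀ {p a b} → IsNu 1 1 M N a → IsNu p p M N b → b ≤ p * a
ν-scaling {M = M} {N} M? N? {p} {a} (_ , ν₁-max) ((A , B , admissible , refl) , _)
  with MinMax.matroid-intersection M N M? N?
... | K , K∈M , K∈N , U , W , covers , cost≤ = begin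
  objective p p A B   ≤⟨ objective≤ {M = M} {N} M? N? admissible covers ⟩
  p * rM U + p * rN W ≡⟨ *-distribˡ-+ p (rM U) (rN W) ⟨
  p * (rM U + rN W)   ≤⟨ *-monoʳ-≤ p (≤-trans cost≤ ∣K∣≤a) ⟩
  p * a               ∎
  where
  open ≤-Reasoning
  open Rank M M? using () renaming (rank to rM)
  open Rank N N? using () renaming (rank to rN)
  ∣K∣≤a : ∣ K ∣ ≤ a
  ∣K∣≤a = subst (_≤ a) (objective-diagonal K) (ν₁-max _ _ ((λ _ → K∈M) , (λ _ → K∈N)))

¬¬-decidable : (P : Subset m → Set) → ¬ ¬ Decidable P
¬¬-decidable {m = ℕ.zero} P ¬P? = ¬¬-excluded-middle (λ P[]? → ¬P? λ { [] → P[]? })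
¬¬-decidable {m = suc m} P ¬P? =
  ¬¬-decidable (P ∘ (inside ∷_)) λ Pin? →
  ¬¬-decidable (P ∘ (outside ∷_)) λ Pout? →
  ¬P? λ { (inside ∷ X) → Pin? X ; (outside ∷ X) → Pout? X }

m≤n*o⇒⌈m/n⌉≤o : ∀ {m o} q → m ≤ suc q * o → ⌈ m / suc q ⌉ ≤ o
m≤n*o⇒⌈m/n⌉≤o {m} {o} q m≤ = ≤-pred (m<n*o⇒m/o<n (begin
  suc (m + q)       ≡⟨ cong suc (+-comm m q) ⟩
  suc q + m         ≤⟨ +-monoʳ-≤ (suc q) (≤-trans m≤ (≤-reflexive (*-comm (suc q) o))) ⟩
  suc o * suc q     ∎))
  where open ≤-Reasoning

lemma4p1 : ∀ {n} (M N : Matroid n) (q : ℕ) (a b : ℕ) →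
           IsNu 1 1 M N a → IsNu (suc q) (suc q) M N b →
           ⌈ b / suc q ⌉ ≤ a
lemma4p1 M N q a b ν₁₁ νqq = m≤n*o⇒⌈m/n⌉≤o q b≤q*a
  where
  -- The bound is decidable, so we may assume that independence is decidable.
  b≤q*a : b ≤ suc q * a
  b≤q*a = decidable-stable (b ≤? suc q * a) λ b≰ →
    ¬¬-decidable (Indep M) λ M? →
    ¬¬-decidable (Indep N) λ N? →
    b≰ (ν-scaling {M = M} {N} M? N? ν₁₁ νqq)
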